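{- Let $n\ge 3$ and $1\le r\le n-2$ be odd integers, and let $K_n$ be the complete graph on $n$ vertices. Then \[ cms_r(K_n)=\left\lfloor \frac{rn-1}{2}\right\rfloor \quad\text{if and only if}\quad cms_{n-1-r}(K_n)=\left\lfloor \frac{(n-1-r)n-1}{2}\right\rfloor. \]
   Context: All graphs are simple. For an integer $N$, $[N]=\{0,1,\dots,N-1\}$. An ordering of a graph $G=(V,E)$ is a bijection $\ell:E\to[|E|]$; edges are cyclically consecutive in $\ell$ if their labels are consecutive integers modulo $|E|$. A graph is $(\le r)$-regular if every vertex has degree at most $r$. For an ordering $\ell$ of $G$, $cms_r(\ell)$ is the largest integer $s$ such that every $s$ cyclically consecutive edges of $\ell$ form a $(\le r)$-regular subgraph of $G$; $cms_r(G)$ is the maximum of $cms_r(\ell)$ over all orderings $\ell$ of $G$. -}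

module Defs where

open import Data.Nat using (ℕ; zero; suc; _+_; _*_; _≤_)
open import Data.Nat.DivMod using (_mod_)
open import Data.Fin using (Fin; toℕ; _<_)
open import Data.Fin.Properties using (_≟_)
open import Data.Product using (Σ; ∃; _×_; _,_; proj₁; proj₂)
open import Data.Sum using (_⊎_)
open import Data.Bool using (Bool; true; false)
open import Relation.Nullary using (Dec; yes; no; does)
open import Relation.Nullary.Decidable using (_⊎-dec_)
open import Relation.Binary.PropositionalEquality using (_≡_)
open import Function.Bundles using (_↔_; Inverse)

Odd : ℕ → Set
Odd n = ∃ λ k → n ≡ suc (2 * k)

-- Edges of the complete graph K_n on vertex set Fin n:
-- unordered pairs {i,j}, i ≠ j, represented as (i , j) with i < j.
Edge : ℕ → Set
Edge n = Σ (Fin n × Fin n) (λ p → proj₁ p < proj₂ p)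

Incident : {n : ℕ} → Fin n → Edge n → Set
Incident v ((i , j) , _) = (v ≡ i) ⊎ (v ≡ j)

incident? : {n : ℕ} → (v : Fin n) → (e : Edge n) → Dec (Incident v e)
incident? v ((i , j) , _) = (v ≟ i) ⊎-dec (v ≟ j)

-- An ordering of K_n: a bijection ℓ : E(K_n) → [m]; necessarily m = |E(K_n)|.
record Ordering (n : ℕ) : Set where
  field
    size  : ℕ
    label : Edge n ↔ Fin size

shift : (m : ℕ) → Fin m → ℕ → Fin m
shift (suc m) a k = (toℕ a + k) mod (suc m)

count : ℕ → (ℕ → Bool) → ℕ
count zero    P = 0
count (suc s) P = count s P + (if P s then 1 else 0)
  where
  if_then_else_ : Bool → ℕ → ℕ → ℕ
  if true  then x else y = x
  if false then x else y = y

module _ {n : ℕ} (ℓ : Ordering n) where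
  open Ordering ℓ
  open Inverse label using (from)

  windowDegree : Fin size → ℕ → Fin n → ℕ
  windowDegree a s v = count s (λ k → does (incident? v (from (shift size a k))))

  WindowsRegular : ℕ → ℕ → Set
  WindowsRegular r s = (a : Fin size) (v : Fin n) → windowDegree a s v ≤ r

-- cms_r(K_n) = c : c is the maximum, over orderings ℓ and window sizes
-- s ≤ |E|, of those s with every s cyclically consecutive edges (≤ r)-regular.
-- (cms_r(ℓ) = largest such s; cms_r(K_n) = max over ℓ of cms_r(ℓ).)
CmsKnEq : (n r c : ℕ) → Set
CmsKnEq n r c =
  (Σ (Ordering n) λ ℓ → c ≤ Ordering.size ℓ × WindowsRegular ℓ r c)
  × ((ℓ : Ordering n) (s : ℕ) → s ≤ Ordering.size ℓ → WindowsRegular ℓ r s → s ≤ c)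

module Submission where

-- By the handshake lemma a (≤ r)-regular window of s edges has 2s ≤ rn, so cms_r(K_n) is at
-- most s_r = (rn − 1)/2, and in a (≤ r)-regular window of s_r edges the degrees fall short of r
-- by rn − 2s_r = 1 in total: a single vertex v has degree r − 1. Appending the next edge e makes
-- every degree at least r: otherwise v ∉ e, both ends of e reach degree r + 1, and since the
-- window shifted by one is (≤ r)-regular again, both ends lie on its dropped first edge, which
-- would then be e itself. As s_r + 1 + s_{n−1−r} = n(n − 1)/2 = |E|, the rest of the cyclic
-- order after a window of s_r + 1 edges is a window of s_{n−1−r} edges, in which every vertex
-- has degree at most (n − 1) − r.

open import Defs
open import Data.Bool using (Bool; true; false)
open import Data.Fin using (Fin; zero; suc; toℕ; splitAt)
open import Data.Fin.Properties using (_≟_; +↔⊎; toℕ<n; toℕ-fromℕ<; fromℕ<-cong; fromℕ<-toℕ)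
open import Data.Nat using (ℕ; zero; suc; _+_; _*_; _∸_; _≤_; _<_; z≤n; s≤s; s≤s⁻¹; NonZero)
open import Data.Nat.Properties hiding (_≟_)
open import Data.Nat.DivMod
  using (_%_; _/_; _mod_; m%n<n; m%n%n≡m%n; [m+n]%n≡m%n; m<n⇒m%n≡m; %-distribˡ-+;
         m≡m%n+[m/n]*n; m*n/n≡m)
open import Data.Nat.Divisibility using (divides; >⇒∤)
open import Data.Nat.Solver using (module +-*-Solver)
open import Algebra.Properties.CommutativeMonoid.Sum +-0-commutativeMonoid
  using (sum; sum-syntax; sum-cong-≗; sum-replicate-zero; ∑-distrib-+; ∑-comm; sum-permute)
open import Data.Product using (_,_; proj₁; proj₂)
open import Data.Sum using (_⊎_; inj₁; inj₂; [_,_]′; map₁; map₂)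
open import Data.Sum.Function.Propositional using (_⊎-↔_)
open import Function using (_∘_; _↔_; _⇔_; Inverse; mk↔ₛ′; mk⇔)
open import Function.Properties.Inverse using (↔-refl; ↔-sym; ↔-trans)
open import Relation.Binary.PropositionalEquality
open import Relation.Nullary using (Dec; yes; no; does; ¬_; contradiction)
open import Relation.Nullary.Decidable using (dec-true; decidable-stable)

open +-*-Solver using (solve; _:+_; _:*_; _:=_; con)

𝟙 : Bool → ℕ
𝟙 true  = 1
𝟙 false = 0

𝟙-does : {A : Set} (a? : Dec A) → A → 𝟙 (does a?) ≡ 1
𝟙-does a? a = cong 𝟙 (dec-true a? a)

𝟙-does⁻¹ : {A : Set} (a? : Dec A) → 1 ≤ 𝟙 (does a?) → A
𝟙-does⁻¹ (yes a) _ = a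

count-snoc : ∀ s P → count (suc s) P ≡ count s P + 𝟙 (P s)
count-snoc s P with P s
... | true  = refl
... | false = refl

count-cong : ∀ s {P Q : ℕ → Bool} → P ≗ Q → count s P ≡ count s Q
count-cong zero    P≗Q = refl
count-cong (suc s) {P} {Q} P≗Q = begin
  count (suc s) P     ≡⟨ count-snoc s P ⟩
  count s P + 𝟙 (P s) ≡⟨ cong₂ _+_ (count-cong s P≗Q) (cong 𝟙 (P≗Q s)) ⟩
  count s Q + 𝟙 (Q s) ≡⟨ count-snoc s Q ⟨
  count (suc s) Q     ∎
  where open ≡-Reasoning

count-+ : ∀ s t P → count (s + t) P ≡ count s P + count t (P ∘ (s +_))
count-+ s zero    P = trans (cong (λ m → count m P) (+-identityʳ s)) (sym (+-identityʳ _))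
count-+ s (suc t) P = begin
  count (s + suc t) P                                ≡⟨ cong (λ m → count m P) (+-suc s t) ⟩
  count (suc (s + t)) P                              ≡⟨ count-snoc (s + t) P ⟩
  count (s + t) P + 𝟙 (P (s + t))                    ≡⟨ cong (_+ 𝟙 (P (s + t))) (count-+ s t P) ⟩
  count s P + count t (P ∘ (s +_)) + 𝟙 (P (s + t))   ≡⟨ +-assoc (count s P) _ _ ⟩
  count s P + (count t (P ∘ (s +_)) + 𝟙 (P (s + t))) ≡⟨ cong (count s P +_) (count-snoc t (P ∘ (s +_))) ⟨
  count s P + count (suc t) (P ∘ (s +_))             ∎
  where open ≡-Reasoning

count-cons : ∀ s P → count (suc s) P ≡ 𝟙 (P 0) + count s (P ∘ suc)
count-cons s P = trans (count-+ 1 s P) (cong (_+ count s (P ∘ suc)) (count-snoc 0 P))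

count-sum : ∀ s P → count s P ≡ ∑[ k < s ] 𝟙 (P (toℕ k))
count-sum zero    P = refl
count-sum (suc s) P = trans (count-cons s P) (cong (𝟙 (P 0) +_) (count-sum s (P ∘ suc)))

count-periodic : ∀ N P → (∀ k → P (N + k) ≡ P k) → ∀ a → count N (P ∘ (a +_)) ≡ count N P
count-periodic zero    P periodic a       = refl
count-periodic (suc N) P periodic zero    = refl
count-periodic (suc N) P periodic (suc a) = begin
  count (suc N) (P ∘ (suc a +_))               ≡⟨ count-snoc N _ ⟩
  count N (P ∘ (suc a +_)) + 𝟙 (P (suc a + N)) ≡⟨ cong₂ _+_ (count-cong N (cong P ∘ sym ∘ +-suc a))
                                                             (cong 𝟙 wrap) ⟩
  count N (P ∘ (a +_) ∘ suc) + 𝟙 (P (a + 0))   ≡⟨ +-comm _ (𝟙 (P (a + 0))) ⟩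
  𝟙 (P (a + 0)) + count N (P ∘ (a +_) ∘ suc)   ≡⟨ count-cons N _ ⟨
  count (suc N) (P ∘ (a +_))                   ≡⟨ count-periodic (suc N) P periodic a ⟩
  count (suc N) P                              ∎
  where
  open ≡-Reasoning
  wrap : P (suc a + N) ≡ P (a + 0)
  wrap = trans (cong (P ∘ suc) (+-comm a N)) (trans (periodic a) (cong P (sym (+-identityʳ a))))

∑-const : ∀ n c → ∑[ i < n ] c ≡ n * c
∑-const zero    c = refl
∑-const (suc n) c = cong (c +_) (∑-const n c)

∑-complement : ∀ {n} (f : Fin n → ℕ) r → (∀ i → f i ≤ r) →
               ∑[ i < n ] f i + ∑[ i < n ] (r ∸ f i) ≡ n * r
∑-complement {n} f r f≤r = begin
  ∑[ i < n ] f i + ∑[ i < n ] (r ∸ f i) ≡⟨ ∑-distrib-+ f (λ i → r ∸ f i) ⟨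
  ∑[ i < n ] (f i + (r ∸ f i))          ≡⟨ sum-cong-≗ (m+[n∸m]≡n ∘ f≤r) ⟩
  ∑[ i < n ] r                          ≡⟨ ∑-const n r ⟩
  n * r                                 ∎
  where open ≡-Reasoning

∑-bounded : ∀ {n} (f : Fin n → ℕ) r → (∀ i → f i ≤ r) → ∑[ i < n ] f i ≤ n * r
∑-bounded f r f≤r = ≤-trans (m≤m+n _ _) (≤-reflexive (∑-complement f r f≤r))

f[i]≤∑f : ∀ {n} (f : Fin n → ℕ) i → f i ≤ sum f
f[i]≤∑f f zero    = m≤m+n _ _
f[i]≤∑f f (suc i) = ≤-trans (f[i]≤∑f (f ∘ suc) i) (m≤n+m _ _)

f[i]+f[j]≤∑f : ∀ {n} (f : Fin n → ℕ) {i j} → i ≢ j → f i + f j ≤ sum f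
f[i]+f[j]≤∑f f {zero}  {zero}  i≢j = contradiction refl i≢j
f[i]+f[j]≤∑f f {zero}  {suc j} _   = +-monoʳ-≤ (f zero) (f[i]≤∑f (f ∘ suc) j)
f[i]+f[j]≤∑f f {suc i} {zero}  _   =
  ≤-trans (≤-reflexive (+-comm (f (suc i)) (f zero))) (+-monoʳ-≤ (f zero) (f[i]≤∑f (f ∘ suc) i))
f[i]+f[j]≤∑f f {suc i} {suc j} i≢j = ≤-trans (f[i]+f[j]≤∑f (f ∘ suc) (i≢j ∘ cong suc)) (m≤n+m _ _)

∑≡1⇒f[j]≡0 : ∀ {n} (f : Fin n → ℕ) {i j} → sum f ≡ 1 → 1 ≤ f i → j ≢ i → f j ≡ 0
∑≡1⇒f[j]≡0 f {i} {j} ∑f≡1 1≤fi j≢i = n≤0⇒n≡0 (+-cancelʳ-≤ 1 (f j) 0 (begin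
  f j + 1   ≤⟨ +-monoʳ-≤ (f j) 1≤fi ⟩
  f j + f i ≤⟨ f[i]+f[j]≤∑f f j≢i ⟩
  sum f     ≡⟨ ∑f≡1 ⟩
  1         ∎))
  where open ≤-Reasoning

∑-δ : ∀ {n} (i : Fin n) → ∑[ j < n ] 𝟙 (does (j ≟ i)) ≡ 1
∑-δ {suc n} zero    = cong suc (sum-replicate-zero n)
∑-δ         (suc i) = ∑-δ i

∑-δ′ : ∀ {n} (i : Fin n) → ∑[ j < n ] 𝟙 (does (i ≟ j)) ≡ 1
∑-δ′ {suc n} zero    = cong suc (sum-replicate-zero n)
∑-δ′         (suc i) = ∑-δ′ i

[m+n]%o≡[m%o+n]%o : ∀ m n o .{{_ : NonZero o}} → (m + n) % o ≡ (m % o + n) % o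
[m+n]%o≡[m%o+n]%o m n o = begin
  (m + n) % o             ≡⟨ %-distribˡ-+ m n o ⟩
  (m % o + n % o) % o     ≡⟨ cong (λ y → (y + n % o) % o) (m%n%n≡m%n m o) ⟨
  (m % o % o + n % o) % o ≡⟨ %-distribˡ-+ (m % o) n o ⟨
  (m % o + n) % o         ∎
  where open ≡-Reasoning

m%o≢[m+n]%o : ∀ m {n o} .{{_ : NonZero o}} → 0 < n → n < o → m % o ≢ (m + n) % o
m%o≢[m+n]%o m {n@(suc _)} {o} _ n<o m%o≡[m+n]%o = >⇒∤ n<o (divides ((y + n) / o) n≡q*o)
  where
  y = m % o
  n≡q*o : n ≡ (y + n) / o * o
  n≡q*o = +-cancelˡ-≡ y _ _ (begin
    y + n                         ≡⟨ m≡m%n+[m/n]*n (y + n) o ⟩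
    (y + n) % o + (y + n) / o * o ≡⟨ cong (_+ (y + n) / o * o) ([m+n]%o≡[m%o+n]%o m n o) ⟨
    (m + n) % o + (y + n) / o * o ≡⟨ cong (_+ (y + n) / o * o) m%o≡[m+n]%o ⟨
    y + (y + n) / o * o           ∎)
    where open ≡-Reasoning

2t≤2s+1⇒t≤s : ∀ {t s} → 2 * t ≤ 2 * s + 1 → t ≤ s
2t≤2s+1⇒t≤s {t} {s} 2t≤2s+1 = s≤s⁻¹ (*-cancelˡ-< 2 t (suc s) (begin-strict
  2 * t           ≤⟨ 2t≤2s+1 ⟩
  2 * s + 1       <⟨ n<1+n (2 * s + 1) ⟩
  suc (2 * s + 1) ≡⟨ cong suc (+-comm (2 * s) 1) ⟩
  2 + 2 * s       ≡⟨ *-suc 2 s ⟨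
  2 * suc s       ∎))
  where open ≤-Reasoning

odd-half : ∀ {m} → Odd m → 2 * ((m ∸ 1) / 2) + 1 ≡ m
odd-half (k , refl) = begin
  2 * ((2 * k) / 2) + 1 ≡⟨ cong (λ y → 2 * (y / 2) + 1) (*-comm 2 k) ⟩
  2 * ((k * 2) / 2) + 1 ≡⟨ cong (λ y → 2 * y + 1) (m*n/n≡m k 2) ⟩
  2 * k + 1             ≡⟨ +-comm (2 * k) 1 ⟩
  suc (2 * k)           ∎
  where open ≡-Reasoning

odd-* : ∀ {m n} → Odd m → Odd n → Odd (m * n)
odd-* (a , refl) (b , refl) = a * suc (2 * b) + b ,
  solve 2 (λ a b → (con 1 :+ con 2 :* a) :* (con 1 :+ con 2 :* b)
                   := con 1 :+ con 2 :* (a :* (con 1 :+ con 2 :* b) :+ b)) refl a b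

odd-complement : ∀ {n r} → Odd n → Odd r → r ≤ n ∸ 2 → Odd (n ∸ 1 ∸ r)
odd-complement (zero  , refl) (q , refl) ()
odd-complement (suc p , refl) (q , refl) r≤n∸2 with m≤n⇒∃[o]m+o≡n q≤p
  where
  q≤p : q ≤ p
  q≤p = s≤s⁻¹ (*-cancelˡ-≤ 2 (begin
    2 * suc q       ≡⟨ *-suc 2 q ⟩
    2 + 2 * q       ≡⟨ +-comm 1 (suc (2 * q)) ⟩
    suc (2 * q) + 1 ≤⟨ m≤o∸n⇒m+n≤o (suc (2 * q)) (s≤s z≤n) r≤n∸2 ⟩
    2 * suc p       ∎))
    where open ≤-Reasoning
... | t , refl = t , (begin
  2 * suc (q + t) ∸ suc (2 * q)           ≡⟨ cong (_∸ suc (2 * q)) (solve 2 (λ q t →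
                                               con 2 :* (con 1 :+ (q :+ t))
                                               := (con 1 :+ con 2 :* q) :+ (con 1 :+ con 2 :* t)) refl q t) ⟩
  suc (2 * q) + suc (2 * t) ∸ suc (2 * q) ≡⟨ m+n∸m≡n (suc (2 * q)) (suc (2 * t)) ⟩
  suc (2 * t)                             ∎)
  where open ≡-Reasoning

half-positive : ∀ {n r s} → 2 * s + 1 ≡ n * r → 3 ≤ n → Odd r → 0 < s
half-positive {s = suc _} _ _ _ = s≤s z≤n
half-positive {n} {s = zero} 1≡nr 3≤n (k , refl) =
  contradiction (≤-trans 3≤n (≤-trans (m≤m*n n (suc (2 * k))) (≤-reflexive (sym 1≡nr)))) λ { (s≤s ()) }

incidence : ∀ {n} → Fin n → Edge n → ℕ
incidence v e = 𝟙 (does (incident? v e))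

incidence-endpoints : ∀ {n} (v : Fin n) (e : Edge n) →
  incidence v e ≡ 𝟙 (does (v ≟ proj₁ (proj₁ e))) + 𝟙 (does (v ≟ proj₂ (proj₁ e)))
incidence-endpoints v ((i , j) , i<j) with v ≟ i | v ≟ j
... | yes refl | yes refl = contradiction i<j (<-irrefl refl)
... | yes _    | no _     = refl
... | no _     | yes _    = refl
... | no _     | no _     = refl

∑-incidence : ∀ {n} (e : Edge n) → ∑[ v < n ] incidence v e ≡ 2
∑-incidence {n} e@((i , j) , _) = begin
  ∑[ v < n ] incidence v e
    ≡⟨ sum-cong-≗ (λ v → incidence-endpoints v e) ⟩
  ∑[ v < n ] (𝟙 (does (v ≟ i)) + 𝟙 (does (v ≟ j)))
    ≡⟨ ∑-distrib-+ (λ v → 𝟙 (does (v ≟ i))) _ ⟩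
  ∑[ v < n ] 𝟙 (does (v ≟ i)) + ∑[ v < n ] 𝟙 (does (v ≟ j))
    ≡⟨ cong₂ _+_ (∑-δ i) (∑-δ j) ⟩
  2 ∎
  where open ≡-Reasoning

handshake : ∀ {n s} (E : Fin s → Edge n) → ∑[ v < n ] ∑[ k < s ] incidence v (E k) ≡ 2 * s
handshake {n} {s} E = begin
  ∑[ v < n ] ∑[ k < s ] incidence v (E k) ≡⟨ ∑-comm (λ v k → incidence v (E k)) ⟩
  ∑[ k < s ] ∑[ v < n ] incidence v (E k) ≡⟨ sum-cong-≗ (∑-incidence ∘ E) ⟩
  ∑[ k < s ] 2                            ≡⟨ ∑-const s 2 ⟩
  s * 2                                   ≡⟨ *-comm s 2 ⟩
  2 * s                                   ∎
  where open ≡-Reasoning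

Incident-⊆⇒≡ : ∀ {n} (e e′ : Edge n) → (∀ u → Incident u e → Incident u e′) → e ≡ e′
Incident-⊆⇒≡ ((i , j) , i<j) ((a , b) , a<b) e⊆e′ with e⊆e′ i (inj₁ refl) | e⊆e′ j (inj₂ refl)
... | inj₁ refl | inj₂ refl = cong ((i , j) ,_) (<-irrelevant i<j a<b)
... | inj₁ refl | inj₁ refl = contradiction i<j (<-irrefl refl)
... | inj₂ refl | inj₂ refl = contradiction i<j (<-irrefl refl)
... | inj₂ refl | inj₁ refl = contradiction a<b (<-asym i<j)

pairs : ℕ → ℕ
pairs zero    = 0
pairs (suc n) = n + pairs n

spoke : ∀ {n} → Fin n → Edge (suc n)
spoke j = (zero , suc j) , s≤s z≤n

lift : ∀ {n} → Edge n → Edge (suc n)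
lift ((i , j) , i<j) = (suc i , suc j) , s≤s i<j

Edge-suc↔ : ∀ {n} → Edge (suc n) ↔ (Fin n ⊎ Edge n)
Edge-suc↔ {n} = mk↔ₛ′ split [ spoke , lift ]′ split∘join join∘split
  where
  split : Edge (suc n) → Fin n ⊎ Edge n
  split ((zero  , suc j) , _)       = inj₁ j
  split ((suc i , suc j) , s≤s i<j) = inj₂ ((i , j) , i<j)

  split∘join : ∀ y → split ([ spoke , lift ]′ y) ≡ y
  split∘join (inj₁ _) = refl
  split∘join (inj₂ _) = refl

  join∘split : ∀ e → [ spoke , lift ]′ (split e) ≡ e
  join∘split ((zero  , suc j) , s≤s z≤n) = refl
  join∘split ((suc i , suc j) , s≤s i<j) = refl

edges↔ : ∀ n → Edge n ↔ Fin (pairs n)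
edges↔ zero    = mk↔ₛ′ (λ { ((() , _) , _) }) (λ ()) (λ ()) (λ { ((() , _) , _) })
edges↔ (suc n) = ↔-trans Edge-suc↔ (↔-trans (↔-refl ⊎-↔ edges↔ n) (↔-sym +↔⊎))

∑-splitAt : ∀ m {k} (g : Fin m ⊎ Fin k → ℕ) →
            ∑[ x < m + k ] g (splitAt m x) ≡ ∑[ i < m ] g (inj₁ i) + ∑[ j < k ] g (inj₂ j)
∑-splitAt zero    g = refl
∑-splitAt (suc m) g = trans (cong (g (inj₁ zero) +_) (∑-splitAt m (g ∘ map₁ suc)))
                            (sym (+-assoc (g (inj₁ zero)) _ _))

∑-edges-suc : ∀ n (f : Edge (suc n) → ℕ) →
  ∑[ x < pairs (suc n) ] f (Inverse.from (edges↔ (suc n)) x)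
    ≡ ∑[ j < n ] f (spoke j) + ∑[ x < pairs n ] f (lift (Inverse.from (edges↔ n) x))
∑-edges-suc n f = ∑-splitAt n (f ∘ [ spoke , lift ]′ ∘ map₂ (Inverse.from (edges↔ n)))

degree-Kₙ : ∀ n (v : Fin n) → ∑[ x < pairs n ] incidence v (Inverse.from (edges↔ n) x) ≡ n ∸ 1
degree-Kₙ (suc n) zero = begin
  ∑[ x < pairs (suc n) ] incidence zero (Inverse.from (edges↔ (suc n)) x)
    ≡⟨ ∑-edges-suc n (incidence zero) ⟩
  ∑[ j < n ] 1 + ∑[ x < pairs n ] 0
    ≡⟨ cong₂ _+_ (∑-const n 1) (sum-replicate-zero (pairs n)) ⟩
  n * 1 + 0
    ≡⟨ trans (+-identityʳ (n * 1)) (*-identityʳ n) ⟩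
  n ∎
  where open ≡-Reasoning
degree-Kₙ (suc (suc n)) (suc v) =
  trans (∑-edges-suc (suc n) (incidence (suc v))) (cong₂ _+_ (∑-δ′ v) (degree-Kₙ (suc n) v))

degree-in-ordering : ∀ {n N} (ℓ : Edge n ↔ Fin N) (v : Fin n) →
                     ∑[ k < N ] incidence v (Inverse.from ℓ k) ≡ n ∸ 1
degree-in-ordering {n} {N} ℓ v = begin
  ∑[ k < N ] incidence v (from ℓ k)
    ≡⟨ sum-permute _ (↔-trans (↔-sym (edges↔ n)) ℓ) ⟩
  ∑[ x < pairs n ] incidence v (from ℓ (to ℓ (from (edges↔ n) x)))
    ≡⟨ sum-cong-≗ (cong (incidence v) ∘ strictlyInverseʳ ℓ ∘ from (edges↔ n)) ⟩
  ∑[ x < pairs n ] incidence v (from (edges↔ n) x)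
    ≡⟨ degree-Kₙ n v ⟩
  n ∸ 1 ∎
  where
  open ≡-Reasoning
  open Inverse

ordering-size : ∀ {n N} (ℓ : Edge n ↔ Fin N) → 2 * N ≡ n * (n ∸ 1)
ordering-size {n} {N} ℓ = begin
  2 * N                                             ≡⟨ handshake (Inverse.from ℓ) ⟨
  ∑[ v < n ] ∑[ k < N ] incidence v (Inverse.from ℓ k) ≡⟨ sum-cong-≗ (degree-in-ordering ℓ) ⟩
  ∑[ v < n ] (n ∸ 1)                                ≡⟨ ∑-const n (n ∸ 1) ⟩
  n * (n ∸ 1)                                       ∎
  where open ≡-Reasoning

module Windows {n : ℕ} (G : ℕ → Edge n) where

  hits : Fin n → ℕ → Bool
  hits v y = does (incident? v (G y))

  window : ℕ → ℕ → Fin n → ℕ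
  window x s v = count s (λ k → hits v (x + k))

  window-+ : ∀ x s t v → window x (s + t) v ≡ window x s v + window (x + s) t v
  window-+ x s t v =
    trans (count-+ s t _) (cong (window x s v +_) (count-cong t (cong (hits v) ∘ sym ∘ +-assoc x s)))

  window-snoc : ∀ x s v → window x (suc s) v ≡ window x s v + incidence v (G (x + s))
  window-snoc x s v = count-snoc s _

  window-cons : ∀ x s v → window x (suc s) v ≡ incidence v (G x) + window (suc x) s v
  window-cons x s v = trans (count-cons s _)
    (cong₂ _+_ (cong (𝟙 ∘ hits v) (+-identityʳ x)) (count-cong s (cong (hits v) ∘ +-suc x)))

  ∑-window : ∀ x s → ∑[ v < n ] window x s v ≡ 2 * s
  ∑-window x s = trans (sum-cong-≗ {n} (λ v → count-sum s _)) (handshake {n} {s} (G ∘ (x +_) ∘ toℕ))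

  module Periodic {N : ℕ}
    (periodic : ∀ k → G (N + k) ≡ G k)
    (distinct : ∀ x s → 0 < s → s < N → G x ≢ G (x + s))
    (degree   : ∀ v → window 0 N v ≡ n ∸ 1)
    where

    window-period : ∀ x v → window x N v ≡ n ∸ 1
    window-period x v =
      trans (count-periodic N (hits v) (cong (λ e → does (incident? v e)) ∘ periodic) x) (degree v)

    module Extremal {r s : ℕ} (0<s : 0 < s) (s<N : s < N) (2s+1≡nr : 2 * s + 1 ≡ n * r)
                    (regular : ∀ x v → window x s v ≤ r) where

      deficiency : ℕ → Fin n → ℕ
      deficiency x v = r ∸ window x s v

      ∑-deficiency : ∀ x → ∑[ v < n ] deficiency x v ≡ 1
      ∑-deficiency x = +-cancelˡ-≡ (2 * s) _ _ (begin
        2 * s + ∑[ v < n ] deficiency x v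
          ≡⟨ cong (_+ ∑[ v < n ] deficiency x v) (∑-window x s) ⟨
        ∑[ v < n ] window x s v + ∑[ v < n ] deficiency x v
          ≡⟨ ∑-complement (λ v → window x s v) r (regular x) ⟩
        n * r
          ≡⟨ 2s+1≡nr ⟨
        2 * s + 1 ∎)
        where open ≡-Reasoning

      saturated-elsewhere : ∀ {x u v} → ¬ r ≤ window x s v → u ≢ v → r ≤ window x s u
      saturated-elsewhere {x} r≰w u≢v =
        m∸n≡0⇒m≤n (∑≡1⇒f[j]≡0 (deficiency x) (∑-deficiency x) (m<n⇒0<n∸m (≰⇒> r≰w)) u≢v)

      saturated⇒on-first-edge : ∀ {x u} → r ≤ window x s u → Incident u (G (x + s)) → Incident u (G x)
      saturated⇒on-first-edge {x} {u} r≤w u∈last = 𝟙-does⁻¹ (incident? u (G x)) (+-cancelʳ-≤ r 1 _ (begin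
        1 + r                                  ≡⟨ +-comm 1 r ⟩
        r + 1                                  ≤⟨ +-monoˡ-≤ 1 r≤w ⟩
        window x s u + 1                       ≡⟨ cong (window x s u +_) (𝟙-does (incident? u (G (x + s))) u∈last) ⟨
        window x s u + incidence u (G (x + s)) ≡⟨ window-snoc x s u ⟨
        window x (suc s) u                     ≡⟨ window-cons x s u ⟩
        incidence u (G x) + window (suc x) s u ≤⟨ +-monoʳ-≤ (incidence u (G x)) (regular (suc x) u) ⟩
        incidence u (G x) + r                  ∎))
        where open ≤-Reasoning

      deficient⇒on-last-edge : ∀ {x v} → ¬ r ≤ window x s v → Incident v (G (x + s))
      deficient⇒on-last-edge {x} {v} r≰w = decidable-stable (incident? v (G (x + s))) λ v∉last →
        distinct x s 0<s s<N (sym (Incident-⊆⇒≡ (G (x + s)) (G x) λ u u∈last →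
          saturated⇒on-first-edge {x} (saturated-elsewhere {x} {u} {v} r≰w (λ { refl → v∉last u∈last }))
                                  u∈last))

      window-grows : ∀ x v → r ≤ window x (suc s) v
      window-grows x v with r ≤? window x s v
      ... | yes r≤w = ≤-trans r≤w (≤-trans (m≤m+n _ _) (≤-reflexive (sym (window-snoc x s v))))
      ... | no r≰w = begin
        r                                      ≤⟨ m≤n+m∸n r (window x s v) ⟩
        window x s v + deficiency x v          ≤⟨ +-monoʳ-≤ (window x s v) deficiency≤1 ⟩
        window x s v + 1                       ≡⟨ cong (window x s v +_) (𝟙-does (incident? v (G (x + s))) v∈last) ⟨
        window x s v + incidence v (G (x + s)) ≡⟨ window-snoc x s v ⟨
        window x (suc s) v                     ∎
        where
        open ≤-Reasoning
        deficiency≤1 : deficiency x v ≤ 1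
        deficiency≤1 = ≤-trans (f[i]≤∑f (deficiency x) v) (≤-reflexive (∑-deficiency x))
        v∈last : Incident v (G (x + s))
        v∈last = deficient⇒on-last-edge {x} r≰w

    complement-regular : ∀ {r r′ s s′} → 0 < s → suc s + s′ ≡ N → 2 * s + 1 ≡ n * r → r + r′ ≡ n ∸ 1 →
                         (∀ x v → window x s v ≤ r) → ∀ x v → window x s′ v ≤ r′
    complement-regular {r} {r′} {s} {s′} 0<s N≡ 2s+1≡nr r+r′≡n∸1 regular x v = +-cancelˡ-≤ r _ _ (begin
      r + window x s′ v                          ≤⟨ +-monoˡ-≤ (window x s′ v) (window-grows (x + s′) v) ⟩
      window (x + s′) (suc s) v + window x s′ v  ≡⟨ +-comm _ (window x s′ v) ⟩
      window x s′ v + window (x + s′) (suc s) v  ≡⟨ window-+ x s′ (suc s) v ⟨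
      window x (s′ + suc s) v                    ≡⟨ cong (λ m → window x m v) (trans (+-comm s′ (suc s)) N≡) ⟩
      window x N v                               ≡⟨ window-period x v ⟩
      n ∸ 1                                      ≡⟨ r+r′≡n∸1 ⟨
      r + r′                                     ∎)
      where
      open ≤-Reasoning
      open Extremal {r} {s} 0<s (≤-trans (m≤m+n (suc s) s′) (≤-reflexive N≡)) 2s+1≡nr regular

module CyclicLabelling {n M : ℕ} (ℓ : Edge n ↔ Fin (suc M)) where
  open Inverse ℓ using (from; to; strictlyInverseˡ)

  cycle : ℕ → Edge n
  cycle j = from (j mod suc M)

  open Windows cycle public

  cycle-cong : ∀ x y → x % suc M ≡ y % suc M → cycle x ≡ cycle y
  cycle-cong x y eq = cong from (fromℕ<-cong _ _ eq (m%n<n x (suc M)) (m%n<n y (suc M)))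

  cycle-injective : ∀ x y → cycle x ≡ cycle y → x % suc M ≡ y % suc M
  cycle-injective x y eq = begin
    x % suc M          ≡⟨ toℕ-fromℕ< (m%n<n x (suc M)) ⟨
    toℕ (x mod suc M)  ≡⟨ cong toℕ (strictlyInverseˡ (x mod suc M)) ⟨
    toℕ (to (cycle x)) ≡⟨ cong (toℕ ∘ to) eq ⟩
    toℕ (to (cycle y)) ≡⟨ cong toℕ (strictlyInverseˡ (y mod suc M)) ⟩
    toℕ (y mod suc M)  ≡⟨ toℕ-fromℕ< (m%n<n y (suc M)) ⟩
    y % suc M          ∎
    where open ≡-Reasoning

  cycle-periodic : ∀ k → cycle (suc M + k) ≡ cycle k
  cycle-periodic k =
    cycle-cong (suc M + k) k (trans (cong (_% suc M) (+-comm (suc M) k)) ([m+n]%n≡m%n k (suc M)))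

  cycle-distinct : ∀ x s → 0 < s → s < suc M → cycle x ≢ cycle (x + s)
  cycle-distinct x s 0<s s<N eq = m%o≢[m+n]%o x 0<s s<N (cycle-injective x (x + s) eq)

  cycle-toℕ : ∀ k → cycle (toℕ k) ≡ from k
  cycle-toℕ k =
    cong from (trans (fromℕ<-cong _ _ (m<n⇒m%n≡m (toℕ<n k)) _ (toℕ<n k)) (fromℕ<-toℕ k (toℕ<n k)))

  cycle-degree : ∀ v → window 0 (suc M) v ≡ n ∸ 1
  cycle-degree v = begin
    window 0 (suc M) v                      ≡⟨ count-sum (suc M) (hits v) ⟩
    ∑[ k < suc M ] incidence v (cycle (toℕ k)) ≡⟨ sum-cong-≗ (cong (incidence v) ∘ cycle-toℕ) ⟩
    ∑[ k < suc M ] incidence v (from k)     ≡⟨ degree-in-ordering ℓ v ⟩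
    n ∸ 1                                   ∎
    where open ≡-Reasoning

  window-mod : ∀ x s v → window x s v ≡ window (toℕ (x mod suc M)) s v
  window-mod x s v = count-cong s λ k →
    cong (λ e → does (incident? v e)) (cycle-cong (x + k) (toℕ (x mod suc M) + k) (begin
      (x + k) % suc M                 ≡⟨ [m+n]%o≡[m%o+n]%o x k (suc M) ⟩
      (x % suc M + k) % suc M         ≡⟨ cong (λ y → (y + k) % suc M) (toℕ-fromℕ< (m%n<n x (suc M))) ⟨
      (toℕ (x mod suc M) + k) % suc M ∎))
    where open ≡-Reasoning

  open Periodic cycle-periodic cycle-distinct cycle-degree public

  regular-everywhere : ∀ {r s} → WindowsRegular (record { size = suc M ; label = ℓ }) r s →
                       ∀ x v → window x s v ≤ r
  regular-everywhere {r} {s} regular x v = ≤-trans (≤-reflexive (window-mod x s v)) (regular (x mod suc M) v)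

cms-upper-bound : ∀ {n r s} → 2 * s + 1 ≡ n * r → (ℓ : Ordering n) (t : ℕ) →
                  t ≤ Ordering.size ℓ → WindowsRegular ℓ r t → t ≤ s
cms-upper-bound _ record { size = zero } t t≤0 _ = ≤-trans t≤0 z≤n
cms-upper-bound {n} {r} {s} 2s+1≡nr record { size = suc M ; label = ℓ } t _ regular =
  2t≤2s+1⇒t≤s (begin
    2 * t                   ≡⟨ ∑-window 0 t ⟨
    ∑[ v < n ] window 0 t v ≤⟨ ∑-bounded (window 0 t) r (regular zero) ⟩
    n * r                   ≡⟨ 2s+1≡nr ⟨
    2 * s + 1               ∎)
  where
  open ≤-Reasoning
  open CyclicLabelling ℓ

cms-complement : ∀ {n r r′ s s′} → 0 < s → 2 * s + 1 ≡ n * r → 2 * s′ + 1 ≡ n * r′ →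
                 r + r′ ≡ n ∸ 1 → CmsKnEq n r s → CmsKnEq n r′ s′
cms-complement 0<s _ _ _ ((record { size = zero } , s≤0 , _) , _) = contradiction s≤0 (<⇒≱ 0<s)
cms-complement {n} {r} {r′} {s} {s′} 0<s 2s+1≡nr 2s′+1≡nr′ r+r′≡n∸1
               ((ordering@record { size = suc M ; label = ℓ } , _ , regular) , _) =
  (ordering , s′≤N , complement) , cms-upper-bound 2s′+1≡nr′
  where
  open CyclicLabelling ℓ

  N-split : suc s + s′ ≡ suc M
  N-split = *-cancelˡ-≡ (suc s + s′) (suc M) 2 (begin
    2 * (suc s + s′)           ≡⟨ solve 2 (λ s s′ → con 2 :* (con 1 :+ s :+ s′)
                                            := (con 2 :* s :+ con 1) :+ (con 2 :* s′ :+ con 1)) refl s s′ ⟩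
    (2 * s + 1) + (2 * s′ + 1) ≡⟨ cong₂ _+_ 2s+1≡nr 2s′+1≡nr′ ⟩
    n * r + n * r′             ≡⟨ *-distribˡ-+ n r r′ ⟨
    n * (r + r′)               ≡⟨ cong (n *_) r+r′≡n∸1 ⟩
    n * (n ∸ 1)                ≡⟨ ordering-size ℓ ⟨
    2 * suc M                  ∎)
    where open ≡-Reasoning

  s′≤N : s′ ≤ suc M
  s′≤N = ≤-trans (m≤n+m s′ (suc s)) (≤-reflexive N-split)

  complement : WindowsRegular ordering r′ s′
  complement a = complement-regular 0<s N-split 2s+1≡nr r+r′≡n∸1 (regular-everywhere {r} {s} regular) (toℕ a)

theorem7 : (n r : ℕ) → Odd n → Odd r → 3 ≤ n → 1 ≤ r → r ≤ n ∸ 2 →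
    (CmsKnEq n r ((r * n ∸ 1) / 2) ⇔ CmsKnEq n (n ∸ 1 ∸ r) (((n ∸ 1 ∸ r) * n ∸ 1) / 2))
theorem7 n r odd-n odd-r 3≤n _ r≤n∸2 =
  mk⇔ (cms-complement 0<s  2s+1≡nr   2s′+1≡nr′ r+r′≡n∸1)
      (cms-complement 0<s′ 2s′+1≡nr′ 2s+1≡nr   (trans (+-comm r′ r) r+r′≡n∸1))
  where
  r′ = n ∸ 1 ∸ r
  odd-r′ = odd-complement odd-n odd-r r≤n∸2
  2s+1≡nr : 2 * ((r * n ∸ 1) / 2) + 1 ≡ n * r
  2s+1≡nr = trans (odd-half (odd-* odd-r odd-n)) (*-comm r n)
  2s′+1≡nr′ : 2 * ((r′ * n ∸ 1) / 2) + 1 ≡ n * r′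
  2s′+1≡nr′ = trans (odd-half (odd-* odd-r′ odd-n)) (*-comm r′ n)
  0<s = half-positive 2s+1≡nr 3≤n odd-r
  0<s′ = half-positive 2s′+1≡nr′ 3≤n odd-r′
  r+r′≡n∸1 : r + r′ ≡ n ∸ 1
  r+r′≡n∸1 = m+[n∸m]≡n (≤-trans r≤n∸2 (∸-monoʳ-≤ n (s≤s z≤n)))
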